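{- (a) The following two statements are equivalent: (A1) for all graphs $G$ and $H$, all positive integers $s$ and $t$, and all vertices $x \in V(G)$, $y \in V(H)$, we have $\pi_{st}(G \times H, (x, y)) \leq \pi_s(G, x)\, \pi_t(H, y)$; (A2) for all graphs $G$ and $H$, all positive odd integers $s$ and $t$, and all vertices $x \in V(G)$, $y \in V(H)$, we have $\pi_{st}(G \times H, (x, y)) \leq \pi_s(G, x)\, \pi_t(H, y)$. (b) The following two statements are equivalent: (B1) for all graphs $G$ and $H$ and all vertices $x \in V(G)$, $y \in V(H)$, we have $\pi(G \times H, (x, y)) \leq \pi(G, x)\, \pi(H, y)$; (B2) for all graphs $G$ and $H$, all nonnegative integers $a$ and $b$, and all vertices $x \in V(G)$, $y \in V(H)$, we have $\pi_{2^{a+b}}(G \times H, (x, y)) \leq \pi_{2^a}(G, x)\, \pi_{2^b}(H, y)$.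
   Context: Graphs are finite and undirected. A distribution on a graph is a function from its vertex set to $\mathbb{N}$ (numbers of pebbles). A pebbling move removes two pebbles from some vertex and places one pebble on an adjacent vertex. For a vertex $v$ of a graph $G$ and positive integer $t$, $\pi_t(G,v)$ is the smallest number $N$ such that, from every distribution with at least $N$ pebbles on $G$, a sequence of pebbling moves yields a distribution with at least $t$ pebbles on $v$ ($\infty$ if no such $N$ exists); $\pi(G,v) = \pi_1(G,v)$. The Cartesian product $G\times H$ has vertex set $V(G)\times V(H)$, with $(x,y)$ adjacent to $(x,y')$ when $yy' \in E(H)$ and to $(x',y)$ when $xx' \in E(G)$. -}

module Defs where

open import Data.Nat using (ℕ; zero; suc; _+_; _*_; _∸_; _^_; _≤_)
open import Data.Bool using (Bool; true; false; _∧_; _∨_; if_then_else_)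
open import Data.Bool.Properties using ()
open import Data.Fin using (Fin; zero; suc; combine; remQuot)
open import Data.Fin.Properties using (_≟_)
open import Data.Product using (Σ; ∃; ∃-syntax; _×_; _,_; proj₁; proj₂)
open import Relation.Nullary using (yes; no)
open import Relation.Nullary.Decidable using (⌊_⌋)
open import Relation.Binary.PropositionalEquality using (_≡_; refl; sym; cong₂)
open import Relation.Binary.Construct.Closure.ReflexiveTransitive using (Star)

record Graph : Set where
  field
    n     : ℕ
    adj   : Fin n → Fin n → Bool
    adj-sym   : ∀ u v → adj u v ≡ adj v u
    adj-irref : ∀ v → adj v v ≡ false
open Graph public

Vertex : Graph → Set
Vertex G = Fin (n G)

-- Cartesian product.  The vertex set Fin (n G * n H) is identified with
-- Fin (n G) × Fin (n H) via the bijection combine / remQuot.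

eqb : ∀ {k} → Fin k → Fin k → Bool
eqb i j = ⌊ i ≟ j ⌋

eqb-sym : ∀ {k} (i j : Fin k) → eqb i j ≡ eqb j i
eqb-sym i j with i ≟ j | j ≟ i
... | yes _ | yes _ = refl
... | no _  | no _  = refl
... | yes p | no ¬q = Data.Empty.⊥-elim (¬q (sym p)) where import Data.Empty
... | no ¬p | yes q = Data.Empty.⊥-elim (¬p (sym q)) where import Data.Empty

eqb-refl : ∀ {k} (i : Fin k) → eqb i i ≡ true
eqb-refl i with i ≟ i
... | yes _ = refl
... | no ¬p = Data.Empty.⊥-elim (¬p refl) where import Data.Empty

pairAdj : (G H : Graph) → Fin (n G) × Fin (n H) → Fin (n G) × Fin (n H) → Bool
pairAdj G H (x , y) (x' , y') = (eqb x x' ∧ adj H y y') ∨ (eqb y y' ∧ adj G x x')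

pairAdj-sym : ∀ G H p q → pairAdj G H p q ≡ pairAdj G H q p
pairAdj-sym G H (x , y) (x' , y')
  rewrite eqb-sym x x' | eqb-sym y y' | adj-sym G x x' | adj-sym H y y' = refl

pairAdj-irref : ∀ G H p → pairAdj G H p p ≡ false
pairAdj-irref G H (x , y)
  rewrite eqb-refl x | eqb-refl y | adj-irref G x | adj-irref H y = refl

_□_ : Graph → Graph → Graph
G □ H = record
  { n = n G * n H
  ; adj = λ p q → pairAdj G H (remQuot (n H) p) (remQuot (n H) q)
  ; adj-sym = λ p q → pairAdj-sym G H (remQuot (n H) p) (remQuot (n H) q)
  ; adj-irref = λ p → pairAdj-irref G H (remQuot (n H) p)
  }

⟨_,_⟩ : ∀ {G H : Graph} → Vertex G → Vertex H → Vertex (G □ H)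
⟨ x , y ⟩ = combine x y

Distribution : Graph → Set
Distribution G = Vertex G → ℕ

total : ∀ {k} → (Fin k → ℕ) → ℕ
total {zero}  D = 0
total {suc k} D = D zero + total (λ i → D (suc i))

Move : (G : Graph) → Distribution G → Distribution G → Set
Move G D D' =
  Σ (Vertex G) λ u → Σ (Vertex G) λ v →
    (adj G u v ≡ true) × (2 ≤ D u) ×
    (∀ w → D' w ≡ (D w ∸ (if eqb w u then 2 else 0)) + (if eqb w v then 1 else 0))

Reach : (G : Graph) → Distribution G → Distribution G → Set
Reach G = Star (Move G)

-- N is a valid t-pebbling bound for v, i.e. π_t(G , v) ≤ N :
-- every distribution with at least N pebbles can move t pebbles to v.
-- Since this property is upward closed in N, π_t(G , v) is the least N
-- satisfying it (or ∞ if none does), so  "π_t(G,v) ≤ N"  ⇔  PiLe G v t N.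
PiLe : (G : Graph) → Vertex G → ℕ → ℕ → Set
PiLe G v t N =
  ∀ (D : Distribution G) → N ≤ total D →
    ∃[ D' ] (Reach G D D' × t ≤ D' v)

Odd : ℕ → Set
Odd s = ∃[ k ] s ≡ suc (2 * k)

-- The inequality  π_{st}(G×H,(x,y)) ≤ π_s(G,x) π_t(H,y)  (with ∞ allowed):
-- for all N ≥ π_s(G,x), M ≥ π_t(H,y) we have π_{st}(G×H,(x,y)) ≤ N M.

ProductIneq : (G H : Graph) → Vertex G → Vertex H → ℕ → ℕ → ℕ → Set
ProductIneq G H x y s t r =
  ∀ N M → PiLe G x s N → PiLe H y t M →
    PiLe (G □ H) (⟨_,_⟩ {G} {H} x y) r (N * M)

A1 : Set
A1 = ∀ (G H : Graph) (s t : ℕ) (x : Vertex G) (y : Vertex H) →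
       1 ≤ s → 1 ≤ t → ProductIneq G H x y s t (s * t)

A2 : Set
A2 = ∀ (G H : Graph) (s t : ℕ) (x : Vertex G) (y : Vertex H) →
       Odd s → Odd t → ProductIneq G H x y s t (s * t)

B1 : Set
B1 = ∀ (G H : Graph) (x : Vertex G) (y : Vertex H) → ProductIneq G H x y 1 1 1

B2 : Set
B2 = ∀ (G H : Graph) (a b : ℕ) (x : Vertex G) (y : Vertex H) →
       ProductIneq G H x y (2 ^ a) (2 ^ b) (2 ^ (a + b))

module Submission where

-- Write π_r(G,x) ≤ N for `PiLe G x r N`, and let `ProductBound s t r` say that
-- π_r(G □ H,(x,y)) ≤ π_s(G,x) · π_t(H,y) for all graphs G, H and vertices x, y.
-- A1 ⇒ A2 and B2 ⇒ B1 are specialisations.  The converses follow from the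
-- doubling step  ProductBound s t r → ProductBound (2s) t (2r)  (bound-double)
-- and the symmetry of □, by writing s = 2^a·s' and t = 2^b·t' with s', t' odd.
--
-- For the doubling step let G⁺ = pendant G x be G with a new vertex p adjacent to x:
--   (1) π_s(G⁺,p) ≤ π_{2s}(G,x)                          (pendant-bound), using
--       π_t(G,x) + c ≤ π_{t+c}(G,x)                      (lower-target);
--   (2) π_{2r}(G □ H,(x,y)) ≤ π_r(G⁺ □ H,(p,y))          (collapse-bound): the
--       p-layer of G⁺ □ H is folded onto the x-layer, one pebble there counting
--       for two, and each move upstairs is matched by at most two moves below.

open import Defs
open import Data.Nat using (ℕ; zero; suc; _+_; _*_; _∸_; _^_; _≤_; _<_; z≤n; s≤s; _≤?_; s≤s⁻¹)
open import Data.Nat.Properties hiding (_≟_; suc-injective)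
open import Data.Bool using (Bool; true; false; _∧_; _∨_; if_then_else_)
open import Data.Fin using (Fin; zero; suc; combine; remQuot; splitAt)
open import Data.Fin.Properties
  using (_≟_; suc-injective; combine-injectiveˡ; combine-injectiveʳ; combine-remQuot; remQuot-combine)
open import Data.Bool.Properties using (∨-comm)
open import Data.Fin.Permutation using (permutation)
open import Data.Product using (∃; ∃-syntax; _×_; _,_; proj₁; proj₂)
open import Data.Empty using (⊥-elim)
open import Data.Sum using (_⊎_; inj₁; inj₂)
open import Data.Nat.Induction using (<-wellFounded)
open import Induction.WellFounded using (Acc; acc)
open import Function.Bundles using (_⇔_; mk⇔)
open import Function using (_∘_)
open import Data.Vec.Functional using (_∷_; _++_)
open import Data.Vec.Functional.Properties using (lookup-++ˡ; lookup-++ʳ)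
open import Data.Sum.Properties using ([,]-map)
open import Relation.Nullary using (Dec; yes; no; contradiction)
open import Relation.Binary.PropositionalEquality
open import Relation.Binary.Construct.Closure.ReflexiveTransitive using (ε; _◅_; _◅◅_)
open import Data.Nat.Tactic.RingSolver using (solve-∀)
import Algebra.Properties.CommutativeMonoid.Sum as Sum

eqb-true : ∀ {k} {i j : Fin k} → i ≡ j → eqb i j ≡ true
eqb-true {i = i} refl = eqb-refl i

eqb-false : ∀ {k} {i j : Fin k} → i ≢ j → eqb i j ≡ false
eqb-false {i = i} {j} i≢j with i ≟ j
... | yes i≡j = ⊥-elim (i≢j i≡j)
... | no _    = refl

eqb-sound : ∀ {k} {i j : Fin k} → eqb i j ≡ true → i ≡ j
eqb-sound {i = i} {j} e with i ≟ j
... | yes i≡j = i≡j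

∧-true : ∀ {p q} → p ∧ q ≡ true → p ≡ true × q ≡ true
∧-true {true} q≡true = refl , q≡true

∨-false : ∀ {p q} → p ∨ (q ∧ false) ≡ true → p ≡ true
∨-false {true}  _ = refl
∨-false {false} {true}  ()
∨-false {false} {false} ()

eqb-⇔ : ∀ {k l} {i j : Fin k} {i' j' : Fin l} →
        (i ≡ j → i' ≡ j') → (i' ≡ j' → i ≡ j) → eqb i j ≡ eqb i' j'
eqb-⇔ {i = i} {j} to from with i ≟ j
... | yes i≡j = sym (eqb-true (to i≡j))
... | no  i≢j = sym (eqb-false (i≢j ∘ from))

eqb-suc : ∀ {k} (i j : Fin k) → eqb {suc k} (suc i) (suc j) ≡ eqb i j
eqb-suc i j = eqb-⇔ suc-injective (cong suc)

eqb-combine : ∀ {m k} (g a : Fin m) (h b : Fin k) →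
              eqb (combine g h) (combine a b) ≡ eqb g a ∧ eqb h b
eqb-combine g a h b with g ≟ a | h ≟ b
... | yes refl | yes refl = eqb-refl (combine g h)
... | yes refl | no h≢b   = eqb-false (h≢b ∘ combine-injectiveʳ g h g b)
... | no g≢a   | _        = eqb-false (g≢a ∘ combine-injectiveˡ g h a b)

pile : ∀ {k} → Fin k → ℕ → Fin k → ℕ
pile u m w = if eqb w u then m else 0

infixl 6 _⊕_
_⊕_ : ∀ {k} → (Fin k → ℕ) → (Fin k → ℕ) → Fin k → ℕ
(D ⊕ E) w = D w + E w

infix 4 _≤ᴰ_
_≤ᴰ_ : ∀ {k} → (Fin k → ℕ) → (Fin k → ℕ) → Set
D ≤ᴰ E = ∀ w → D w ≤ E w

≤ᴰ-trans : ∀ {k} {D E F : Fin k → ℕ} → D ≤ᴰ E → E ≤ᴰ F → D ≤ᴰ F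
≤ᴰ-trans D≤E E≤F w = ≤-trans (D≤E w) (E≤F w)

pile-self : ∀ {k} (u : Fin k) m → pile u m u ≡ m
pile-self u m rewrite eqb-refl u = refl

pile-+ : ∀ {k} (u : Fin k) a b → pile u (a + b) ≗ pile u a ⊕ pile u b
pile-+ u a b w with eqb w u
... | true  = refl
... | false = refl

pile-away : ∀ {k} {u w : Fin k} m → w ≢ u → pile u m w ≡ 0
pile-away m w≢u = cong (λ b → if b then m else 0) (eqb-false w≢u)

pile-mono : ∀ {k} (u : Fin k) {a b} → a ≤ b → pile u a ≤ᴰ pile u b
pile-mono u a≤b w with eqb w u
... | true  = a≤b
... | false = z≤n

pile-below : ∀ {k} (D : Fin k → ℕ) u {m} → m ≤ D u → pile u m ≤ᴰ D
pile-below D u m≤Du w with w ≟ u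
... | yes refl = m≤Du
... | no _     = z≤n

fire : ∀ {k} → (Fin k → ℕ) → Fin k → Fin k → Fin k → ℕ
fire F u v w = (F w ∸ pile u 2 w) + pile v 1 w

fire-move : ∀ G {F u v} → adj G u v ≡ true → 2 ≤ F u → Move G F (fire F u v)
fire-move G uv 2≤Fu = _ , _ , uv , 2≤Fu , λ w → refl

simulate : ∀ (A B : Graph) (R : Distribution A → Distribution B → Set) →
  (∀ {F F₁ E} → R F E → Move A F F₁ → ∃[ E₁ ] (Reach B E E₁ × R F₁ E₁)) →
  ∀ {F F₁ E} → R F E → Reach A F F₁ → ∃[ E₁ ] (Reach B E E₁ × R F₁ E₁)
simulate A B R follow {E = E} r ε = E , ε , r
simulate A B R follow r (m ◅ ms) with follow r m
... | E₁ , rs₁ , r₁ with simulate A B R follow r₁ ms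
...   | E₂ , rs₂ , r₂ = E₂ , rs₁ ◅◅ rs₂ , r₂

move-mono : ∀ G {F F₁ E} → F ≤ᴰ E → Move G F F₁ → ∃[ E₁ ] (Move G E E₁ × F₁ ≤ᴰ E₁)
move-mono G {E = E} F≤E (u , v , uv , 2≤Fu , eq) =
  fire E u v , fire-move G uv (≤-trans 2≤Fu (F≤E u)) ,
  λ w → ≤-trans (≤-reflexive (eq w)) (+-monoˡ-≤ (pile v 1 w) (∸-monoˡ-≤ (pile u 2 w) (F≤E w)))

reach-mono : ∀ G {F F₁ E} → F ≤ᴰ E → Reach G F F₁ → ∃[ E₁ ] (Reach G E E₁ × F₁ ≤ᴰ E₁)
reach-mono G = simulate G G (λ F E → F ≤ᴰ E) follow
  where
    follow : ∀ {F F₁ E} → F ≤ᴰ E → Move G F F₁ → ∃[ E₁ ] (Reach G E E₁ × F₁ ≤ᴰ E₁)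
    follow F≤E m with move-mono G F≤E m
    ... | E₁ , m₁ , F₁≤E₁ = E₁ , m₁ ◅ ε , F₁≤E₁

simulate-map : ∀ (A B : Graph) (φ : Distribution A → Distribution B) →
  (∀ {F F₁} → Move A F F₁ → ∃[ E₁ ] (Reach B (φ F) E₁ × φ F₁ ≤ᴰ E₁)) →
  ∀ {F F₁ E} → φ F ≤ᴰ E → Reach A F F₁ → ∃[ E₁ ] (Reach B E E₁ × φ F₁ ≤ᴰ E₁)
simulate-map A B φ match = simulate A B (λ F E → φ F ≤ᴰ E) follow
  where
    follow : ∀ {F F₁ E} → φ F ≤ᴰ E → Move A F F₁ → ∃[ E₁ ] (Reach B E E₁ × φ F₁ ≤ᴰ E₁)
    follow φF≤E m with match m
    ... | E₁ , rs₁ , φF₁≤E₁ with reach-mono B φF≤E rs₁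
    ...   | E₂ , rs₂ , E₁≤E₂ = E₂ , rs₂ , ≤ᴰ-trans φF₁≤E₁ E₁≤E₂

total-cong : ∀ {k} {D E : Fin k → ℕ} → D ≗ E → total D ≡ total E
total-cong {zero}  D≗E = refl
total-cong {suc k} D≗E = cong₂ _+_ (D≗E zero) (total-cong (D≗E ∘ suc))

total-empty : ∀ k → total {k} (λ _ → 0) ≡ 0
total-empty zero    = refl
total-empty (suc k) = total-empty k

total-⊕ : ∀ {k} (D E : Fin k → ℕ) → total (D ⊕ E) ≡ total D + total E
total-⊕ {zero}  D E = refl
total-⊕ {suc k} D E = begin
  (D zero + E zero) + total ((D ∘ suc) ⊕ (E ∘ suc))
    ≡⟨ cong ((D zero + E zero) +_) (total-⊕ (D ∘ suc) (E ∘ suc)) ⟩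
  (D zero + E zero) + (total (D ∘ suc) + total (E ∘ suc))
    ≡⟨ interchange (D zero) (E zero) _ _ ⟩
  (D zero + total (D ∘ suc)) + (E zero + total (E ∘ suc)) ∎
  where
    open ≡-Reasoning
    interchange : ∀ a b c d → (a + b) + (c + d) ≡ (a + c) + (b + d)
    interchange = solve-∀

total-pile : ∀ {k} (u : Fin k) m → total (pile u m) ≡ m
total-pile {suc k} zero    m = trans (cong (m +_) (total-empty k)) (+-identityʳ m)
total-pile {suc k} (suc u) m =
  trans (total-cong (λ i → cong (λ b → if b then m else 0) (eqb-suc i u))) (total-pile u m)

total-++ : ∀ {m k} (A : Fin m → ℕ) (B : Fin k → ℕ) → total (A ++ B) ≡ total A + total B
total-++ {zero}  A B = refl
total-++ {suc m} A B =
  trans (cong (A zero +_) (trans (total-cong (λ i → [,]-map (splitAt m i))) (total-++ (A ∘ suc) B)))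
        (sym (+-assoc (A zero) _ _))

total-permute : ∀ {m k} (f : Fin m → Fin k) (g : Fin k → Fin m) →
                (∀ i → f (g i) ≡ i) → (∀ i → g (f i) ≡ i) →
                (D : Fin k → ℕ) → total (D ∘ f) ≡ total D
total-permute f g fg gf D = begin
  total (D ∘ f)  ≡⟨ total-sum (D ∘ f) ⟩
  sum (D ∘ f)    ≡⟨ sym (sum-permute D (permutation f g fg gf)) ⟩
  sum D          ≡⟨ sym (total-sum D) ⟩
  total D        ∎
  where
    open ≡-Reasoning
    open Sum +-0-commutativeMonoid using (sum; sum-permute)
    total-sum : ∀ {k} (D : Fin k → ℕ) → total D ≡ sum D
    total-sum {zero}  D = refl
    total-sum {suc k} D = cong (D zero +_) (total-sum (D ∘ suc))

-- Lowering the target: a configuration with one pebble more than F, placed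
-- anywhere, can do no more than F plus one pebble.  Hence π_t(G,x) + c ≤ π_{t+c}(G,x).

OneExtra : (G : Graph) → Distribution G → Distribution G → Set
OneExtra G F' F = ∃[ z ] (F' ≤ᴰ F ⊕ pile z 1)

pile-one : ∀ {k} (z w : Fin k) → pile z 1 w ≤ 1
pile-one z w with eqb w z
... | true  = ≤-refl
... | false = z≤n

one-extra-follow : ∀ G {F' F'₁ F} → OneExtra G F' F → Move G F' F'₁ →
                   ∃[ F₁ ] (Reach G F F₁ × OneExtra G F'₁ F₁)
one-extra-follow G {F'} {F'₁} {F} (z , F'≤F+z) (u , v , uv , 2≤F'u , eq) with 2 ≤? F u
... | yes 2≤Fu = fire F u v , fire-move G uv 2≤Fu ◅ ε , z , F'₁≤F₁+z
  where
    F'₁≤F₁+z : F'₁ ≤ᴰ fire F u v ⊕ pile z 1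
    F'₁≤F₁+z w = begin
      F'₁ w
        ≡⟨ eq w ⟩
      (F' w ∸ pile u 2 w) + pile v 1 w
        ≤⟨ +-monoˡ-≤ (pile v 1 w) (∸-monoˡ-≤ (pile u 2 w) (F'≤F+z w)) ⟩
      (F w + pile z 1 w ∸ pile u 2 w) + pile v 1 w
        ≡⟨ cong (_+ pile v 1 w) (+-∸-comm (pile z 1 w) (pile-below F u 2≤Fu w)) ⟩
      (F w ∸ pile u 2 w) + pile z 1 w + pile v 1 w
        ≡⟨ swap₂₃ (F w ∸ pile u 2 w) (pile z 1 w) (pile v 1 w) ⟩
      fire F u v w + pile z 1 w ∎
      where
        open ≤-Reasoning
        swap₂₃ : ∀ a b c → a + b + c ≡ a + c + b
        swap₂₃ = solve-∀
... | no 2≰Fu = F , ε , v , F'₁≤F+v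
  where
    -- F has at most one pebble on u, so the extra pebble of F' must sit on u.
    Fu≤1 : F u ≤ 1
    Fu≤1 = s≤s⁻¹ (≰⇒> 2≰Fu)
    z≡u : z ≡ u
    z≡u with u ≟ z
    ... | yes u≡z = sym u≡z
    ... | no  u≢z = ⊥-elim (2≰Fu (≤-trans 2≤F'u (≤-trans (F'≤F+z u)
                      (≤-reflexive (trans (cong (F u +_) (pile-away 1 u≢z)) (+-identityʳ (F u)))))))
    removed≤F : ∀ w → Dec (w ≡ u) → F' w ∸ pile u 2 w ≤ F w
    removed≤F w (yes refl) = begin
      F' w ∸ pile w 2 w   ≡⟨ cong (F' w ∸_) (pile-self w 2) ⟩
      F' w ∸ 2            ≡⟨ m≤n⇒m∸n≡0 (≤-trans (F'≤F+z w) (+-mono-≤ Fu≤1 (pile-one z w))) ⟩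
      0                   ≤⟨ z≤n ⟩
      F w                 ∎
      where open ≤-Reasoning
    removed≤F w (no w≢u) = begin
      F' w ∸ pile u 2 w   ≡⟨ cong (F' w ∸_) (pile-away 2 w≢u) ⟩
      F' w                ≤⟨ F'≤F+z w ⟩
      F w + pile z 1 w    ≡⟨ cong (F w +_) (pile-away 1 (λ w≡z → w≢u (trans w≡z z≡u))) ⟩
      F w + 0             ≡⟨ +-identityʳ (F w) ⟩
      F w                 ∎
      where open ≤-Reasoning
    F'₁≤F+v : F'₁ ≤ᴰ F ⊕ pile v 1
    F'₁≤F+v w = ≤-trans (≤-reflexive (eq w)) (+-monoˡ-≤ (pile v 1 w) (removed≤F w (w ≟ u)))

-- π_t(G,x) + 1 ≤ π_{t+1}(G,x): add a pebble on x and simulate with one pebble less.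
lower-target-by-one : ∀ G x t N → PiLe G x (suc t) N → PiLe G x t (N ∸ 1)
lower-target-by-one G x t N bound D N∸1≤D with bound (D ⊕ pile x 1) N≤D+x
  where
    N≤D+x : N ≤ total (D ⊕ pile x 1)
    N≤D+x = begin
      N                             ≤⟨ m≤n+m∸n N 1 ⟩
      1 + (N ∸ 1)                   ≤⟨ +-monoʳ-≤ 1 N∸1≤D ⟩
      1 + total D                   ≡⟨ +-comm 1 (total D) ⟩
      total D + 1                   ≡⟨ cong (total D +_) (sym (total-pile x 1)) ⟩
      total D + total (pile x 1)    ≡⟨ sym (total-⊕ D (pile x 1)) ⟩
      total (D ⊕ pile x 1)          ∎
      where open ≤-Reasoning
... | E' , rs' , 1+t≤E'x with simulate G G (OneExtra G) (one-extra-follow G) (x , λ w → ≤-refl) rs'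
...   | E , rs , z , E'≤E+z = E , rs , +-cancelʳ-≤ 1 t (E x) (begin
  t + 1              ≡⟨ +-comm t 1 ⟩
  suc t              ≤⟨ 1+t≤E'x ⟩
  E' x               ≤⟨ E'≤E+z x ⟩
  E x + pile z 1 x   ≤⟨ +-monoʳ-≤ (E x) (pile-one z x) ⟩
  E x + 1            ∎)
  where open ≤-Reasoning

lower-target : ∀ G x t c N → PiLe G x (t + c) N → PiLe G x t (N ∸ c)
lower-target G x t zero    N bound = subst (λ r → PiLe G x r N) (+-identityʳ t) bound
lower-target G x t (suc c) N bound =
  subst (PiLe G x t) (∸-+-assoc N 1 c)
    (lower-target G x t c (N ∸ 1)
      (lower-target-by-one G x (t + c) N (subst (λ r → PiLe G x r N) (+-suc t c) bound)))

module Isomorphism (A B : Graph) (f : Vertex A → Vertex B) (g : Vertex B → Vertex A)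
  (gf : ∀ u → g (f u) ≡ u) (fg : ∀ v → f (g v) ≡ v)
  (f-adj : ∀ u u' → adj B (f u) (f u') ≡ adj A u u') where

  pile-transport : ∀ u m w → pile u m (g w) ≡ pile (f u) m w
  pile-transport u m w = cong (λ b → if b then m else 0)
    (eqb-⇔ (λ g-w≡u → trans (sym (fg w)) (cong f g-w≡u)) (λ w≡fu → trans (cong g w≡fu) (gf u)))

  transport : ∀ {F F₁} → Move A F F₁ → ∃[ E₁ ] (Reach B (F ∘ g) E₁ × F₁ ∘ g ≤ᴰ E₁)
  transport {F} {F₁} (u , v , uv , 2≤Fu , eq) =
    F₁ ∘ g ,
    (f u , f v , trans (f-adj u v) uv , subst (λ a → 2 ≤ F a) (sym (gf u)) 2≤Fu , moved) ◅ ε ,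
    λ w → ≤-refl
    where
      moved : ∀ w → F₁ (g w) ≡ (F (g w) ∸ pile (f u) 2 w) + pile (f v) 1 w
      moved w = trans (eq (g w))
                      (cong₂ (λ p q → (F (g w) ∸ p) + q) (pile-transport u 2 w) (pile-transport v 1 w))

  PiLe-iso : ∀ a t N → PiLe A a t N → PiLe B (f a) t N
  PiLe-iso a t N bound D N≤D
    with bound (D ∘ f) (subst (N ≤_) (sym (total-permute f g fg gf D)) N≤D)
  ... | E' , rs' , t≤E'a with simulate-map A B (_∘ g) transport (λ v → ≤-reflexive (cong D (fg v))) rs'
  ...   | E , rs , E'g≤E =
    E , rs , ≤-trans t≤E'a (≤-trans (≤-reflexive (cong E' (sym (gf a)))) (E'g≤E (f a)))

open Isomorphism using (PiLe-iso)

row : ∀ G H → Vertex (G □ H) → Vertex G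
row G H w = proj₁ (remQuot {n G} (n H) w)

col : ∀ G H → Vertex (G □ H) → Vertex H
col G H w = proj₂ (remQuot {n G} (n H) w)

□-adj : ∀ G H (g g' : Vertex G) (h h' : Vertex H) →
        adj (G □ H) (combine g h) (combine g' h') ≡ pairAdj G H (g , h) (g' , h')
□-adj G H g g' h h' = cong₂ (pairAdj G H) (remQuot-combine g h) (remQuot-combine g' h')

□-adj-col : ∀ G H (g : Vertex G) {h h' : Vertex H} → adj H h h' ≡ true →
            adj (G □ H) (combine g h) (combine g h') ≡ true
□-adj-col G H g {h} {h'} hh' =
  trans (□-adj G H g g h h') (cong₂ (λ s t → (s ∧ t) ∨ (eqb h h' ∧ adj G g g)) (eqb-refl g) hh')

pile-combine : ∀ {m k} (a g : Fin m) (b h : Fin k) c →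
               pile (combine a b) c (combine g h) ≡ (if eqb g a ∧ eqb h b then c else 0)
pile-combine a g b h c = cong (λ t → if t then c else 0) (eqb-combine g a h b)

□-ext : ∀ G H {D E : Distribution (G □ H)} →
        (∀ g h → D (combine g h) ≡ E (combine g h)) → D ≗ E
□-ext G H {D} {E} agree w =
  subst (λ v → D v ≡ E v) (combine-remQuot {n G} (n H) w) (agree (row G H w) (col G H w))

swap : ∀ G H → Vertex (G □ H) → Vertex (H □ G)
swap G H w = combine (col G H w) (row G H w)

swap-combine : ∀ G H (g : Vertex G) (h : Vertex H) → swap G H (combine g h) ≡ combine h g
swap-combine G H g h = cong (λ p → combine (proj₂ p) (proj₁ p)) (remQuot-combine g h)

swap-swap : ∀ G H w → swap H G (swap G H w) ≡ w
swap-swap G H w = trans (swap-combine H G (col G H w) (row G H w)) (combine-remQuot {n G} (n H) w)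

swap-adj : ∀ G H w w' → adj (H □ G) (swap G H w) (swap G H w') ≡ adj (G □ H) w w'
swap-adj G H w w' = trans (□-adj H G h h' g g') (∨-comm (eqb h h' ∧ adj G g g') (eqb g g' ∧ adj H h h'))
  where
    g = row G H w
    h = col G H w
    g' = row G H w'
    h' = col G H w'

PiLe-swap : ∀ G H (x : Vertex G) (y : Vertex H) t N →
            PiLe (G □ H) (combine x y) t N → PiLe (H □ G) (combine y x) t N
PiLe-swap G H x y t N bound =
  subst (λ v → PiLe (H □ G) v t N) (swap-combine G H x y)
    (PiLe-iso (G □ H) (H □ G) (swap G H) (swap H G) (swap-swap G H) (swap-swap H G) (swap-adj G H)
              (combine x y) t N bound)

-- Attaching a pendant vertex.  `pendant G x` is G with a new vertex zero
-- adjacent exactly to x; the old vertex i becomes suc i.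

pendant-adj : (G : Graph) → Vertex G → Fin (suc (n G)) → Fin (suc (n G)) → Bool
pendant-adj G x zero    zero    = false
pendant-adj G x zero    (suc v) = eqb v x
pendant-adj G x (suc u) zero    = eqb u x
pendant-adj G x (suc u) (suc v) = adj G u v

pendant : (G : Graph) → Vertex G → Graph
pendant G x = record { n = suc (n G) ; adj = pendant-adj G x ; adj-sym = sym′ ; adj-irref = irref }
  where
    sym′ : ∀ u v → pendant-adj G x u v ≡ pendant-adj G x v u
    sym′ zero    zero    = refl
    sym′ zero    (suc v) = refl
    sym′ (suc u) zero    = refl
    sym′ (suc u) (suc v) = adj-sym G u v
    irref : ∀ u → pendant-adj G x u u ≡ false
    irref zero    = refl
    irref (suc u) = adj-irref G u

pendant-lift : ∀ G x c {F F₁} → Move G F F₁ → Move (pendant G x) (c ∷ F) (c ∷ F₁)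
pendant-lift G x c {F} {F₁} (u , v , uv , 2≤Fu , eq) = suc u , suc v , uv , 2≤Fu , moved
  where
    moved : ∀ w → (c ∷ F₁) w ≡ ((c ∷ F) w ∸ pile (suc u) 2 w) + pile (suc v) 1 w
    moved zero    = sym (+-identityʳ c)
    moved (suc w) = trans (eq w) (cong₂ (λ p q → (F w ∸ (if p then 2 else 0)) + (if q then 1 else 0))
                                        (sym (eqb-suc w u)) (sym (eqb-suc w v)))

push-to-pendant : ∀ G x k (F : Distribution (pendant G x)) → 2 * k ≤ F (suc x) →
                  ∃[ F₁ ] (Reach (pendant G x) F F₁ × F zero + k ≤ F₁ zero)
push-to-pendant G x zero    F _ = F , ε , ≤-reflexive (+-identityʳ (F zero))
push-to-pendant G x (suc k) F 2[1+k]≤F =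
  proj₁ pushed ,
  fire-move (pendant G x) (eqb-refl x) (≤-trans (m≤m+n 2 (2 * k)) 2+2k≤F) ◅ proj₁ (proj₂ pushed) ,
  ≤-trans (≤-reflexive (sym (+-assoc (F zero) 1 k))) (proj₂ (proj₂ pushed))
  where
    2+2k≤F : 2 + 2 * k ≤ F (suc x)
    2+2k≤F = subst (_≤ F (suc x)) (*-suc 2 k) 2[1+k]≤F
    2k≤F₁ : 2 * k ≤ fire F (suc x) zero (suc x)
    2k≤F₁ = begin
      2 * k                          ≡⟨ sym (m+n∸m≡n 2 (2 * k)) ⟩
      2 + 2 * k ∸ 2                  ≤⟨ ∸-monoˡ-≤ 2 2+2k≤F ⟩
      F (suc x) ∸ 2                  ≡⟨ sym (+-identityʳ _) ⟩
      (F (suc x) ∸ 2) + 0            ≡⟨ cong (λ p → (F (suc x) ∸ p) + 0) (sym (pile-self (suc x) 2)) ⟩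
      fire F (suc x) zero (suc x)    ∎
      where open ≤-Reasoning
    pushed : ∃[ F₂ ] (Reach (pendant G x) (fire F (suc x) zero) F₂ × F zero + 1 + k ≤ F₂ zero)
    pushed = push-to-pendant G x k (fire F (suc x) zero) 2k≤F₁

twice-monus : ∀ s c → 2 * (s ∸ c) ≤ 2 * s ∸ c
twice-monus s c = begin
  2 * (s ∸ c)      ≡⟨ *-distribˡ-∸ 2 s c ⟩
  2 * s ∸ 2 * c    ≤⟨ ∸-monoʳ-≤ (2 * s) (m≤m+n c (c + 0)) ⟩
  2 * s ∸ c        ∎
  where open ≤-Reasoning

-- π_s(pendant G x, new vertex) ≤ π_{2s}(G, x): keep the c < s pebbles already on
-- the pendant vertex, gather 2s - c ≥ 2(s - c) pebbles on x and push s - c of them over.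
pendant-bound : ∀ G x s N → PiLe G x (2 * s) N → PiLe (pendant G x) zero s N
pendant-bound G x s N bound D N≤D with s ≤? D zero
... | yes s≤c = D , ε , s≤c
... | no  s≰c = top-up (<⇒≤ (≰⇒> s≰c))
  where
    c = D zero
    gather : c ≤ s → ∃[ E ] (Reach G (D ∘ suc) E × 2 * s ∸ c ≤ E x)
    gather c≤s = lower-target G x (2 * s ∸ c) c N (subst (λ r → PiLe G x r N) (sym (m∸n+n≡m c≤2s)) bound)
                   (D ∘ suc) (m≤n+o⇒m∸n≤o N c N≤D)
      where
        c≤2s : c ≤ 2 * s
        c≤2s = ≤-trans c≤s (m≤m+n s (s + 0))
    lifted : ∀ {E} → Reach G (D ∘ suc) E → ∃[ E* ] (Reach (pendant G x) D E* × (c ∷ E) ≤ᴰ E*)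
    lifted = simulate-map G (pendant G x) (c ∷_) (λ m → _ , pendant-lift G x c m ◅ ε , λ w → ≤-refl)
               (λ { zero → ≤-refl ; (suc i) → ≤-refl })
    top-up : c ≤ s → ∃[ F ] (Reach (pendant G x) D F × s ≤ F zero)
    top-up c≤s with gather c≤s
    ... | E , rs , 2s-c≤Ex with lifted rs
    ...   | E* , rs* , c∷E≤E*
      with push-to-pendant G x (s ∸ c) E* (≤-trans (twice-monus s c) (≤-trans 2s-c≤Ex (c∷E≤E* (suc x))))
    ...     | F , rs' , c+[s-c]≤F = F , rs* ◅◅ rs' , (begin
      s                  ≡⟨ sym (m+[n∸m]≡n c≤s) ⟩
      c + (s ∸ c)        ≤⟨ +-monoˡ-≤ (s ∸ c) (c∷E≤E* zero) ⟩
      E* zero + (s ∸ c)  ≤⟨ c+[s-c]≤F ⟩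
      F zero             ∎)
      where open ≤-Reasoning

-- Pebbling moves viewed additively: D = R + 2·u and E = R + 1·v for an edge uv.
-- This is the form in which moves are compared across the collapse map below.

record Step (G : Graph) (D E : Distribution G) : Set where
  field
    from to : Vertex G
    edge    : adj G from to ≡ true
    rest    : Distribution G
    before  : D ≗ rest ⊕ pile from 2
    after   : E ≗ rest ⊕ pile to 1

move⇒step : ∀ G {D E} → Move G D E → Step G D E
move⇒step G {D} (u , v , uv , 2≤Du , eq) = record
  { from = u ; to = v ; edge = uv ; rest = λ w → D w ∸ pile u 2 w
  ; before = λ w → sym (m∸n+n≡m (pile-below D u 2≤Du w))
  ; after = eq }

step⇒move : ∀ G {D E} → Step G D E → Move G D E
step⇒move G {D} {E} s = from , to , edge , 2≤D , removed
  where
    open Step s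
    2≤D : 2 ≤ D from
    2≤D = ≤-trans (m≤n+m 2 (rest from))
            (≤-reflexive (trans (cong (rest from +_) (sym (pile-self from 2))) (sym (before from))))
    removed : ∀ w → E w ≡ (D w ∸ pile from 2 w) + pile to 1 w
    removed w = begin
      E w
        ≡⟨ after w ⟩
      rest w + pile to 1 w
        ≡⟨ cong (_+ pile to 1 w) (sym (m+n∸n≡m (rest w) (pile from 2 w))) ⟩
      (rest w + pile from 2 w ∸ pile from 2 w) + pile to 1 w
        ≡⟨ cong (λ n → (n ∸ pile from 2 w) + pile to 1 w) (sym (before w)) ⟩
      (D w ∸ pile from 2 w) + pile to 1 w ∎
      where open ≡-Reasoning

double-move : ∀ G {D E R u v} → adj G u v ≡ true → D ≗ R ⊕ pile u 4 → E ≗ R ⊕ pile v 2 → Reach G D E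
double-move G {D} {E} {R} {u} {v} uv D≗R+4u E≗R+2v =
  step⇒move G first ◅ step⇒move G second ◅ ε
  where
    M : Distribution G
    M = R ⊕ pile u 2 ⊕ pile v 1
    reassoc : ∀ a b c → a + (b + c) ≡ a + b + c
    reassoc a b c = sym (+-assoc a b c)
    swap₂₃ : ∀ a b c → a + b + c ≡ a + c + b
    swap₂₃ = solve-∀
    first : Step G D M
    first = record { from = u ; to = v ; edge = uv ; rest = R ⊕ pile u 2
                   ; before = λ w → trans (D≗R+4u w) (trans (cong (R w +_) (pile-+ u 2 2 w)) (reassoc (R w) _ _))
                   ; after = λ w → refl }
    second : Step G M E
    second = record { from = u ; to = v ; edge = uv ; rest = R ⊕ pile v 1
                    ; before = λ w → swap₂₃ (R w) (pile u 2 w) (pile v 1 w)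
                    ; after = λ w → trans (E≗R+2v w) (trans (cong (R w +_) (pile-+ v 1 1 w)) (reassoc (R w) _ _)) }

-- In P = pendant G x □ H the copy of H at the
-- pendant vertex is folded onto the copy at x, one pebble there counting for two:
--   collapse F ⟨g , h⟩ = F ⟨suc g , h⟩ + [g = x]·2·F ⟨zero , h⟩.
module Collapse (G H : Graph) (x : Vertex G) where

  P : Graph
  P = pendant G x □ H

  Q : Graph
  Q = G □ H

  layer : Vertex G → Vertex H → Vertex P
  layer g h = combine (suc g) h

  top : Vertex H → Vertex P
  top h = combine {suc (n G)} zero h

  bonus : Vertex G → ℕ → ℕ
  bonus g a = if eqb g x then 2 * a else 0

  collapse : Distribution P → Distribution Q
  collapse F w = F (layer (row G H w) (col G H w)) + bonus (row G H w) (F (top (col G H w)))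

  collapse-at : ∀ F g h → collapse F (combine g h) ≡ F (layer g h) + bonus g (F (top h))
  collapse-at F g h = cong (λ p → F (layer (proj₁ p) (proj₂ p)) + bonus (proj₁ p) (F (top (proj₂ p))))
                           (remQuot-combine g h)

  bonus-⊕ : ∀ g a b → bonus g (a + b) ≡ bonus g a + bonus g b
  bonus-⊕ g a b with eqb g x
  ... | true  = *-distribˡ-+ 2 a b
  ... | false = refl

  bonus-x : ∀ a → bonus x a ≡ 2 * a
  bonus-x a = cong (λ t → if t then 2 * a else 0) (eqb-refl x)

  bonus-zero : ∀ g → bonus g 0 ≡ 0
  bonus-zero g with eqb g x
  ... | true  = refl
  ... | false = refl

  collapse-⊕ : ∀ A B → collapse (A ⊕ B) ≗ collapse A ⊕ collapse B
  collapse-⊕ A B w = begin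
    (A l + B l) + bonus g (A t + B t)          ≡⟨ cong ((A l + B l) +_) (bonus-⊕ g (A t) (B t)) ⟩
    (A l + B l) + (bonus g (A t) + bonus g (B t)) ≡⟨ interchange (A l) (B l) _ _ ⟩
    (A l + bonus g (A t)) + (B l + bonus g (B t)) ∎
    where
      open ≡-Reasoning
      g = row G H w
      l = layer g (col G H w)
      t = top (col G H w)
      interchange : ∀ a b c d → (a + b) + (c + d) ≡ (a + c) + (b + d)
      interchange = solve-∀

  collapse-cong : ∀ {A B} → A ≗ B → collapse A ≗ collapse B
  collapse-cong A≗B w = cong₂ _+_ (A≗B _) (cong (bonus (row G H w)) (A≗B _))

  collapse-split : ∀ {F} R u k → F ≗ R ⊕ pile u k → collapse F ≗ collapse R ⊕ collapse (pile u k)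
  collapse-split R u k F≗ w = trans (collapse-cong F≗ w) (collapse-⊕ R (pile u k) w)

  collapse-layer : ∀ g h c → collapse (pile (layer g h) c) ≗ pile (combine g h) c
  collapse-layer g h c = □-ext G H λ g' h' → begin
    collapse (pile (layer g h) c) (combine g' h')
      ≡⟨ collapse-at (pile (layer g h) c) g' h' ⟩
    pile (layer g h) c (layer g' h') + bonus g' (pile (layer g h) c (top h'))
      ≡⟨ cong₂ _+_ (pile-combine (suc g) (suc g') h h' c)
                   (trans (cong (bonus g') (pile-combine {suc (n G)} (suc g) zero h h' c)) (bonus-zero g')) ⟩
    (if eqb {suc (n G)} (suc g') (suc g) ∧ eqb h' h then c else 0) + 0
      ≡⟨ +-identityʳ _ ⟩
    (if eqb {suc (n G)} (suc g') (suc g) ∧ eqb h' h then c else 0)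
      ≡⟨ cong (λ t → if t ∧ eqb h' h then c else 0) (eqb-suc g' g) ⟩
    (if eqb g' g ∧ eqb h' h then c else 0)
      ≡⟨ sym (pile-combine g g' h h' c) ⟩
    pile (combine g h) c (combine g' h') ∎
    where open ≡-Reasoning

  collapse-top : ∀ h c → collapse (pile (top h) c) ≗ pile (combine x h) (2 * c)
  collapse-top h c = □-ext G H λ g' h' → begin
    collapse (pile (top h) c) (combine g' h')
      ≡⟨ collapse-at (pile (top h) c) g' h' ⟩
    pile (top h) c (layer g' h') + bonus g' (pile (top h) c (top h'))
      ≡⟨ cong₂ (λ a b → a + bonus g' b) (pile-combine {suc (n G)} zero (suc g') h h' c)
                                        (pile-combine {suc (n G)} zero zero h h' c) ⟩
    0 + bonus g' (if eqb h' h then c else 0)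
      ≡⟨ fold (eqb g' x) (eqb h' h) ⟩
    (if eqb g' x ∧ eqb h' h then 2 * c else 0)
      ≡⟨ sym (pile-combine x g' h h' (2 * c)) ⟩
    pile (combine x h) (2 * c) (combine g' h') ∎
    where
      open ≡-Reasoning
      fold : ∀ s t → 0 + (if s then 2 * (if t then c else 0) else 0) ≡ (if s ∧ t then 2 * c else 0)
      fold true  true  = refl
      fold true  false = refl
      fold false _     = refl

  -- Moves inside the G-layers are copied; a move inside the
  -- pendant layer (2 pebbles, worth 4) becomes two moves inside the x-layer.
  collapse-step : ∀ {F F₁} a b c d R → pairAdj (pendant G x) H (a , b) (c , d) ≡ true →
    F ≗ R ⊕ pile (combine a b) 2 → F₁ ≗ R ⊕ pile (combine c d) 1 →
    ∃[ E ] (Reach Q (collapse F) E × collapse F₁ ≤ᴰ E)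
  collapse-step {F} {F₁} (suc g) b (suc g') d R ab~cd F≗ F₁≗ =
    collapse F₁ , step⇒move Q copy ◅ ε , (λ w → ≤-refl)
    where
      copy : Step Q (collapse F) (collapse F₁)
      copy = record
        { from = combine g b ; to = combine g' d ; rest = collapse R
        ; edge = trans (□-adj G H g g' b d)
                   (trans (cong (λ t → (t ∧ adj H b d) ∨ (eqb b d ∧ adj G g g')) (sym (eqb-suc g g'))) ab~cd)
        ; before = λ w → trans (collapse-split R _ 2 F≗ w) (cong (collapse R w +_) (collapse-layer g b 2 w))
        ; after  = λ w → trans (collapse-split R _ 1 F₁≗ w) (cong (collapse R w +_) (collapse-layer g' d 1 w)) }
  collapse-step {F} {F₁} zero b zero d R ab~cd F≗ F₁≗ =
    collapse F₁ ,
    double-move Q (□-adj-col G H x (∨-false ab~cd))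
      (λ w → trans (collapse-split R _ 2 F≗ w) (cong (collapse R w +_) (collapse-top b 2 w)))
      (λ w → trans (collapse-split R _ 1 F₁≗ w) (cong (collapse R w +_) (collapse-top d 1 w))) ,
    λ w → ≤-refl
  collapse-step {F} {F₁} (suc g) b zero d R ab~cd F≗ F₁≗
    with eqb-sound {i = b} {d} (proj₁ (∧-true ab~cd)) | eqb-sound {i = g} {x} (proj₂ (∧-true {eqb b d} ab~cd))
  ... | refl | refl = collapse F , ε , λ w → ≤-reflexive (begin
    collapse F₁ w                                         ≡⟨ collapse-split R _ 1 F₁≗ w ⟩
    collapse R w + collapse (pile (top b) 1) w            ≡⟨ cong (collapse R w +_) (collapse-top b 1 w) ⟩
    collapse R w + pile (combine g b) 2 w                 ≡⟨ cong (collapse R w +_) (sym (collapse-layer g b 2 w)) ⟩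
    collapse R w + collapse (pile (layer g b) 2) w        ≡⟨ sym (collapse-split R _ 2 F≗ w) ⟩
    collapse F w                                          ∎)
    where open ≡-Reasoning
  collapse-step {F} {F₁} zero b (suc g') d R ab~cd F≗ F₁≗
    with eqb-sound {i = b} {d} (proj₁ (∧-true ab~cd)) | eqb-sound {i = g'} {x} (proj₂ (∧-true {eqb b d} ab~cd))
  ... | refl | refl = collapse F , ε , λ w → begin
    collapse F₁ w                                    ≡⟨ collapse-split R _ 1 F₁≗ w ⟩
    collapse R w + collapse (pile (layer g' b) 1) w  ≡⟨ cong (collapse R w +_) (collapse-layer g' b 1 w) ⟩
    collapse R w + pile (combine g' b) 1 w           ≤⟨ +-monoʳ-≤ (collapse R w) (pile-mono _ (s≤s z≤n) w) ⟩
    collapse R w + pile (combine g' b) 4 w           ≡⟨ cong (collapse R w +_) (sym (collapse-top b 2 w)) ⟩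
    collapse R w + collapse (pile (top b) 2) w       ≡⟨ sym (collapse-split R _ 2 F≗ w) ⟩
    collapse F w                                     ∎
    where open ≤-Reasoning

  collapse-move : ∀ {F F₁} → Move P F F₁ → ∃[ E ] (Reach Q (collapse F) E × collapse F₁ ≤ᴰ E)
  collapse-move m = collapse-step (row′ from) (col′ from) (row′ to) (col′ to) rest edge
                      (λ w → trans (before w) (cong (λ u → rest w + pile u 2 w) (sym (combine-remQuot (n H) from))))
                      (λ w → trans (after w) (cong (λ v → rest w + pile v 1 w) (sym (combine-remQuot (n H) to))))
    where
      open Step (move⇒step P m)
      row′ = row (pendant G x) H
      col′ = col (pendant G x) H

  -- A distribution on Q, placed on the G-layers of P with an empty pendant layer.
  lift : Distribution Q → Distribution P
  lift D = (λ _ → 0) ++ D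

  total-lift : ∀ D → total (lift D) ≡ total D
  total-lift D = trans (total-++ {n H} (λ _ → 0) D) (cong (_+ total D) (total-empty (n H)))

  collapse-lift : ∀ D → collapse (lift D) ≤ᴰ D
  collapse-lift D w = ≤-reflexive (begin
    lift D (layer g h) + bonus g (lift D (top h))
      ≡⟨ cong₂ (λ a b → a + bonus g b) (lookup-++ʳ {m = n H} (λ _ → 0) D (combine g h))
                                       (lookup-++ˡ {m = n H} (λ _ → 0) D h) ⟩
    D (combine g h) + bonus g 0   ≡⟨ cong (D (combine g h) +_) (bonus-zero g) ⟩
    D (combine g h) + 0           ≡⟨ +-identityʳ _ ⟩
    D (combine g h)               ≡⟨ cong D (combine-remQuot {n G} (n H) w) ⟩
    D w                           ∎)
    where
      open ≡-Reasoning
      g = row G H w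
      h = col G H w

  collapse-bound : ∀ y r K → PiLe P (top y) r K → PiLe Q (combine x y) (2 * r) K
  collapse-bound y r K bound D K≤D with bound (lift D) (subst (K ≤_) (sym (total-lift D)) K≤D)
  ... | E' , rs' , r≤E'y with simulate-map P Q collapse collapse-move (collapse-lift D) rs'
  ...   | E , rs , collapse-E'≤E = E , rs , (begin
    2 * r                                  ≤⟨ *-monoʳ-≤ 2 r≤E'y ⟩
    2 * E' (top y)                         ≤⟨ m≤n+m (2 * E' (top y)) (E' (layer x y)) ⟩
    E' (layer x y) + 2 * E' (top y)        ≡⟨ cong (E' (layer x y) +_) (sym (bonus-x (E' (top y)))) ⟩
    E' (layer x y) + bonus x (E' (top y))  ≡⟨ sym (collapse-at E' x y) ⟩
    collapse E' (combine x y)              ≤⟨ collapse-E'≤E (combine x y) ⟩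
    E (combine x y)                        ∎)
    where open ≤-Reasoning

ProductBound : ℕ → ℕ → ℕ → Set
ProductBound s t r = ∀ G H (x : Vertex G) (y : Vertex H) → ProductIneq G H x y s t r

bound-cast : ∀ {s t r s' t' r'} → s ≡ s' → t ≡ t' → r ≡ r' → ProductBound s t r → ProductBound s' t' r'
bound-cast refl refl refl q = q

bound-swap : ∀ {s t r} → ProductBound s t r → ProductBound t s r
bound-swap {r = r} q H G y x N M y-bound x-bound =
  subst (PiLe (H □ G) (combine y x) r) (*-comm M N) (PiLe-swap G H x y r (M * N) (q G H x y M N x-bound y-bound))

-- The key step: doubling s doubles the target.  Apply the bound for s to the
-- pendant graph (π_s(G+pendant) ≤ π_{2s}(G)) and collapse the pendant layer.
bound-double : ∀ {s t r} → ProductBound s t r → ProductBound (2 * s) t (2 * r)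
bound-double {s} {r = r} q G H x y N M x-bound y-bound =
  Collapse.collapse-bound G H x y r (N * M) (q (pendant G x) H zero y N M (pendant-bound G x s N x-bound) y-bound)

bound-double-left : ∀ a {s t r} → ProductBound s t r → ProductBound (2 ^ a * s) t (2 ^ a * r)
bound-double-left zero    {s} {r = r} q = bound-cast (sym (+-identityʳ s)) refl (sym (+-identityʳ r)) q
bound-double-left (suc a) {s} {r = r} q =
  bound-cast (sym (*-assoc 2 (2 ^ a) s)) refl (sym (*-assoc 2 (2 ^ a) r)) (bound-double (bound-double-left a q))

bound-scale : ∀ a b {s t r} → ProductBound s t r → ProductBound (2 ^ a * s) (2 ^ b * t) (2 ^ (a + b) * r)
bound-scale a b {r = r} q =
  bound-cast refl refl powers (bound-swap (bound-double-left b (bound-swap (bound-double-left a q))))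
  where
    powers : 2 ^ b * (2 ^ a * r) ≡ 2 ^ (a + b) * r
    powers = begin
      2 ^ b * (2 ^ a * r)    ≡⟨ sym (*-assoc (2 ^ b) (2 ^ a) r) ⟩
      2 ^ b * 2 ^ a * r      ≡⟨ cong (_* r) (*-comm (2 ^ b) (2 ^ a)) ⟩
      2 ^ a * 2 ^ b * r      ≡⟨ cong (_* r) (sym (^-distribˡ-+-* 2 a b)) ⟩
      2 ^ (a + b) * r        ∎
      where open ≡-Reasoning

parity : ∀ m → (∃[ k ] m ≡ 2 * k) ⊎ Odd m
parity zero    = inj₁ (0 , refl)
parity (suc m) with parity m
... | inj₁ (k , m≡2k)  = inj₂ (k , cong suc m≡2k)
... | inj₂ (k , m≡1+2k) = inj₁ (suc k , trans (cong suc m≡1+2k) (sym (*-suc 2 k)))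

odd-part : ∀ s → 1 ≤ s → ∃[ a ] ∃[ s' ] (Odd s' × s ≡ 2 ^ a * s')
odd-part s 1≤s = go s 1≤s (<-wellFounded s)
  where
    go : ∀ s → 1 ≤ s → Acc _<_ s → ∃[ a ] ∃[ s' ] (Odd s' × s ≡ 2 ^ a * s')
    go s 1≤s (acc smaller) with parity s
    ... | inj₂ odd = 0 , s , odd , sym (+-identityʳ s)
    ... | inj₁ (zero  , refl) = contradiction 1≤s λ ()
    ... | inj₁ (suc k , refl) with go (suc k) (s≤s z≤n) (smaller (m<m+n (suc k) (s≤s z≤n)))
    ...   | a , s' , odd , k≡ = suc a , s' , odd , trans (cong (2 *_) k≡) (sym (*-assoc 2 (2 ^ a) s'))

odd⇒positive : ∀ {s} → Odd s → 1 ≤ s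
odd⇒positive (k , refl) = s≤s z≤n

A1⇒A2 : A1 → A2
A1⇒A2 a1 G H s t x y odd-s odd-t = a1 G H s t x y (odd⇒positive odd-s) (odd⇒positive odd-t)

A2⇒A1 : A2 → A1
A2⇒A1 a2 G H s t x y 1≤s 1≤t with odd-part s 1≤s | odd-part t 1≤t
... | a , s' , odd-s' , refl | b , t' , odd-t' , refl =
  bound-cast refl refl (product (2 ^ a) (2 ^ b) s' t' (^-distribˡ-+-* 2 a b))
    (bound-scale a b (λ G H x y → a2 G H s' t' x y odd-s' odd-t')) G H x y
  where
    product : ∀ A B s' t' {C} → C ≡ A * B → C * (s' * t') ≡ A * s' * (B * t')
    product A B s' t' refl = rearrange A B s' t'
      where
        rearrange : ∀ A B s' t' → A * B * (s' * t') ≡ A * s' * (B * t')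
        rearrange = solve-∀

B1⇒B2 : B1 → B2
B1⇒B2 b1 G H a b x y =
  bound-cast (*-identityʳ (2 ^ a)) (*-identityʳ (2 ^ b)) (*-identityʳ (2 ^ (a + b))) (bound-scale a b b1) G H x y

B2⇒B1 : B2 → B1
B2⇒B1 b2 G H x y = b2 G H 0 0 x y

theorem3p8 : (A1 ⇔ A2) × (B1 ⇔ B2)
theorem3p8 = mk⇔ A1⇒A2 A2⇒A1 , mk⇔ B1⇒B2 B2⇒B1
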